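{- Let $k\ge 1$ be an integer and $n\in\{8k,\,8k+2\}$. Define the edge set $T_n=T'_n\cup T''_n\cup T'''_n\cup \bar T_n$ on vertex set $\{0,1,\ldots,n-1\}$ by: if $n=8k$, $T'_n=\{\{1+i,\,8k-2-i\}: i=0,1,\ldots,2k-3\}$, $T''_n=\{\{2k+i,\,6k-i\}: i=0,1,\ldots,k-1\}$, $T'''_n=\{\{3k+i,\,5k-2-i\}: i=0,1,\ldots,k-2\}$, $\bar T_n=\{\{0,4k-1\},\{2k-1,8k-1\},\{5k-1,5k\}\}$; if $n=8k+2$, $T'_n=\{\{1+i,\,8k-i\}: i=0,1,\ldots,2k-2\}$, $T''_n=\{\{2k+1+i,\,6k+1-i\}: i=0,1,\ldots,k-1\}$, $T'''_n=\{\{3k+1+i,\,5k-1-i\}: i=0,1,\ldots,k-2\}$, $\bar T_n=\{\{0,2k\},\{4k,8k+1\},\{5k,5k+1\}\}$ (an index range with upper bound smaller than $0$ gives the empty set). Then $T_n$ is a rainbow perfect matching in $K^\bullet_n$.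
   Context: For an integer $n\ge 1$, $K^\bullet_n$ denotes the complete graph on vertex set $V=\{0,1,\ldots,n-1\}$ whose edges are colored by the circular-distance edge coloring: the edge $\{i,j\}$ receives color $c_{\min\{|i-j|,\,n-|i-j|\}}$, where $c_1,c_2,\ldots$ are distinct colors. Thus exactly $\lfloor n/2\rfloor$ colors are used. A rainbow matching is a matching (set of pairwise vertex-disjoint edges) whose edges have pairwise distinct colors. For $n$ even, a rainbow perfect matching in $K^\bullet_n$ is a rainbow matching covering all $n$ vertices. -}

module Defs where

open import Data.Nat using (ℕ; _+_; _*_; _∸_; _<_; _⊓_; ∣_-_∣)
open import Data.Product using (_×_; _,_; proj₁; proj₂)
open import Data.Sum using (_⊎_)
open import Data.List using (List; map; upTo; _++_; _∷_; [])
open import Data.List.Relation.Unary.Any using (Any)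
open import Data.List.Relation.Unary.All using (All)
open import Data.List.Relation.Unary.AllPairs using (AllPairs)
open import Relation.Binary.PropositionalEquality using (_≡_; _≢_)

-- An edge {i,j} is represented by an (unordered-meaning) pair (i , j).
Edge : Set
Edge = ℕ × ℕ

-- circular-distance color index of edge {i,j} in K•_n : min(|i-j|, n-|i-j|)
color : ℕ → Edge → ℕ
color n (i , j) = ∣ i - j ∣ ⊓ (n ∸ ∣ i - j ∣)

IsEdgeOf : ℕ → Edge → Set
IsEdgeOf n (i , j) = i < n × j < n × i ≢ j

Disjoint : Edge → Edge → Set
Disjoint (a , b) (c , d) = a ≢ c × a ≢ d × b ≢ c × b ≢ d

Covers : ℕ → Edge → Set
Covers v (i , j) = v ≡ i ⊎ v ≡ j

IsMatching : ℕ → List Edge → Set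
IsMatching n M = All (IsEdgeOf n) M × AllPairs Disjoint M

IsRainbow : ℕ → List Edge → Set
IsRainbow n M = AllPairs (λ e f → color n e ≢ color n f) M

IsPerfect : ℕ → List Edge → Set
IsPerfect n M = ∀ v → v < n → Any (Covers v) M

IsRainbowPerfectMatching : ℕ → List Edge → Set
IsRainbowPerfectMatching n M = IsMatching n M × IsRainbow n M × IsPerfect n M

T8k : ℕ → List Edge
T8k k =
     map (λ i → (1 + i , 8 * k ∸ 2 ∸ i)) (upTo (2 * k ∸ 2))
  ++ map (λ i → (2 * k + i , 6 * k ∸ i)) (upTo k)
  ++ map (λ i → (3 * k + i , 5 * k ∸ 2 ∸ i)) (upTo (k ∸ 1))
  ++ (0 , 4 * k ∸ 1) ∷ (2 * k ∸ 1 , 8 * k ∸ 1) ∷ (5 * k ∸ 1 , 5 * k) ∷ []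

T8k+2 : ℕ → List Edge
T8k+2 k =
     map (λ i → (1 + i , 8 * k ∸ i)) (upTo (2 * k ∸ 1))
  ++ map (λ i → (2 * k + 1 + i , 6 * k + 1 ∸ i)) (upTo k)
  ++ map (λ i → (3 * k + 1 + i , 5 * k ∸ 1 ∸ i)) (upTo (k ∸ 1))
  ++ (0 , 2 * k) ∷ (4 * k , 8 * k + 1) ∷ (5 * k , 5 * k + 1) ∷ []

-- Put k = m + 1 and l = 2m (n = 8k) or l = 2m + 1 (n = 8k + 2), so that n = 8 + 2l + 4m.
-- Each of T′, T″, T‴ is a ladder of edges {a + i, b − i}: its left ends run up through an
-- interval and its right ends run down through another. Together with the six vertices of
-- the three edges of T̄ these intervals tile {0, …, n − 1}, so the list of all endpoints is a
-- permutation of 0, …, n − 1, which makes T_n a perfect matching. The edges of T′ are long,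
-- of colors 3, 5, …, 2l + 1, while T″ and T‴ are short, of colors 2m + 4, …, 4m + 4 and
-- 2, …, 2m; with the colors 1, 2m + 2 and 2l + 3 of T̄ every odd number up to 2l + 3 and
-- every even number up to 4m + 4 occurs exactly once, so T_n is rainbow.
module Submission where

open import Defs
open import Data.Nat using (ℕ; zero; suc; _+_; _*_; _∸_; _≤_; _<_; _⊓_; s≤s; z≤n)
open import Data.Nat.Properties
open import Data.Nat.Tactic.RingSolver using (solve)
open import Data.Product using (_×_; _,_; proj₁; proj₂; ∃-syntax)
open import Data.Sum using (inj₁; inj₂)
open import Data.Empty using (⊥)
open import Data.List using (List; []; _∷_; _++_; _∷ʳ_; map; upTo; applyUpTo)
open import Data.List.Properties using (map-++; map-∘; map-cong-local; map-upTo; upTo-∷ʳ)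
open import Data.List.Relation.Unary.All as All using (All)
open import Data.List.Relation.Unary.All.Properties using (all-upTo)
open import Data.List.Relation.Unary.Any using (Any; here; there)
import Data.List.Relation.Unary.AllPairs.Properties as AllPairs
open import Data.List.Relation.Unary.Unique.Propositional using (Unique)
import Data.List.Relation.Unary.Unique.Propositional.Properties as Unique
open import Data.List.Membership.Propositional using (_∈_)
open import Data.List.Membership.Propositional.Properties using (∈-upTo⁺; ∈-map⁻)
open import Data.List.Relation.Binary.Permutation.Propositional
  using (_↭_; ↭-refl; ↭-sym; ↭-trans; ↭-reflexive; prep; swap; ↭⇒↭ₛ; module PermutationReasoning)
open import Data.List.Relation.Binary.Permutation.Propositional.Properties
  using (shift; ∷↭∷ʳ; ↭-reverse; All-resp-↭; ∈-resp-↭; ++⁺; ++⁺ˡ; ++⁺ʳ; map⁺; ++-commutativeMonoid)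
open import Function using (_∘_)
open import Relation.Binary.PropositionalEquality
open import Data.List.Relation.Binary.Permutation.Setoid.Properties (setoid ℕ) using (Unique-resp-↭)
open import Algebra.Solver.CommutativeMonoid (++-commutativeMonoid {A = ℕ})
  using (_⊕_; _⊜_) renaming (solve to ++-solve)

m≡n+o⇒m∸n≡o : ∀ {m} n {o} → m ≡ n + o → m ∸ n ≡ o
m≡n+o⇒m∸n≡o n {o} refl = m+n∸m≡n n o

m+n≡o⇒m≤o : ∀ {m o} n → m + n ≡ o → m ≤ o
m+n≡o⇒m≤o {m} n refl = m≤m+n m n

odd : ℕ → ℕ
odd h = 1 + 2 * h

range : ℕ → ℕ → List ℕ
range a zero    = []
range a (suc l) = a ∷ range (suc a) l

range-++ : ∀ a l l′ → range a (l + l′) ≡ range a l ++ range (a + l) l′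
range-++ a zero    l′ = cong (λ b → range b l′) (sym (+-identityʳ a))
range-++ a (suc l) l′ = cong (a ∷_) (begin
  range (suc a) (l + l′)                  ≡⟨ range-++ (suc a) l l′ ⟩
  range (suc a) l ++ range (suc a + l) l′ ≡⟨ cong (λ b → range (suc a) l ++ range b l′) (+-suc a l) ⟨
  range (suc a) l ++ range (a + suc l) l′ ∎)
  where open ≡-Reasoning

++-range : ∀ a {b} l {l′ xs} → a + l ≡ b → xs ≡ range b l′ → range a l ++ xs ≡ range a (l + l′)
++-range a l {l′} refl refl = sym (range-++ a l l′)

∷-range : ∀ a {l xs} → xs ≡ range (suc a) l → a ∷ xs ≡ range a (suc l)
∷-range a = cong (a ∷_)

applyUpTo≡range : ∀ {f} a l → (∀ i → f i ≡ a + i) → applyUpTo f l ≡ range a l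
applyUpTo≡range a zero    f≗ = refl
applyUpTo≡range a (suc l) f≗ =
  cong₂ _∷_ (trans (f≗ 0) (+-identityʳ a)) (applyUpTo≡range (suc a) l (λ i → trans (f≗ (suc i)) (+-suc a i)))

map-+-upTo : ∀ a l → map (a +_) (upTo l) ≡ range a l
map-+-upTo a l = trans (map-upTo (a +_) l) (applyUpTo≡range a l (λ _ → refl))

upTo≡range : ∀ n → upTo n ≡ range 0 n
upTo≡range n = applyUpTo≡range 0 n (λ _ → refl)

range-unique : ∀ a l → Unique (range a l)
range-unique a l = subst Unique (map-+-upTo a l) (Unique.map⁺ (+-cancelˡ-≡ a _ _) (Unique.upTo⁺ l))

map-∸-upTo : ∀ {b c} l → c + l ≡ suc b → map (b ∸_) (upTo l) ↭ range c l
map-∸-upTo         zero    _        = ↭-refl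
map-∸-upTo {b} {c} (suc l) c+l+1≡b+1 = begin
  map (b ∸_) (upTo (suc l))      ≡⟨ cong (map (b ∸_)) (upTo-∷ʳ l) ⟨
  map (b ∸_) (upTo l ∷ʳ l)       ≡⟨ map-++ (b ∸_) (upTo l) (l ∷ []) ⟩
  map (b ∸_) (upTo l) ∷ʳ (b ∸ l) ↭⟨ ∷↭∷ʳ (b ∸ l) (map (b ∸_) (upTo l)) ⟨
  b ∸ l ∷ map (b ∸_) (upTo l)    ≡⟨ cong (_∷ map (b ∸_) (upTo l)) b∸l≡c ⟩
  c ∷ map (b ∸_) (upTo l)        ↭⟨ prep c (map-∸-upTo l (trans (sym (+-suc c l)) c+l+1≡b+1)) ⟩
  c ∷ range (suc c) l            ∎
  where
  open PermutationReasoning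
  c+l≡b : c + l ≡ b
  c+l≡b = suc-injective (trans (sym (+-suc c l)) c+l+1≡b+1)
  b∸l≡c : b ∸ l ≡ c
  b∸l≡c = m≡n+o⇒m∸n≡o l (trans (sym c+l≡b) (+-comm c l))

odds-evens-unique : ∀ a k b j → Unique (map odd (range a k) ++ map (2 *_) (range b j))
odds-evens-unique a k b j =
  Unique.++⁺ (Unique.map⁺ odd-injective (range-unique a k)) (Unique.map⁺ (*-cancelˡ-≡ _ _ 2) (range-unique b j))
    λ (v∈odds , v∈evens) → parity (∈-map⁻ odd v∈odds) (∈-map⁻ (2 *_) v∈evens)
  where
  odd-injective : ∀ {x y} → odd x ≡ odd y → x ≡ y
  odd-injective eq = *-cancelˡ-≡ _ _ 2 (suc-injective eq)
  parity : ∀ {v} → ∃[ x ] x ∈ range a k × v ≡ odd x → ∃[ y ] y ∈ range b j × v ≡ 2 * y → ⊥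
  parity (x , _ , v≡odd) (y , _ , v≡even) = even≢odd y x (trans (sym v≡even) v≡odd)

endpoints : List Edge → List ℕ
endpoints []            = []
endpoints ((i , j) ∷ M) = i ∷ j ∷ endpoints M

endpoints-++ : ∀ M N → endpoints (M ++ N) ≡ endpoints M ++ endpoints N
endpoints-++ []            N = refl
endpoints-++ ((i , j) ∷ M) N = cong (λ vs → i ∷ j ∷ vs) (endpoints-++ M N)

endpoints-map : ∀ {A : Set} (f g : A → ℕ) xs → endpoints (map (λ x → f x , g x) xs) ↭ map f xs ++ map g xs
endpoints-map f g []       = ↭-refl
endpoints-map f g (x ∷ xs) =
  prep (f x) (↭-trans (prep (g x) (endpoints-map f g xs)) (↭-sym (shift (g x) (map f xs) (map g xs))))

-- The constructors of All and AllPairs are opened only here: elsewhere they would make the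
-- list literals given to the ring solver ambiguous.
module _ where
  open import Data.List.Relation.Unary.All using ([]; _∷_)
  open import Data.List.Relation.Unary.AllPairs using ([]; _∷_)

  All-Disjoint : ∀ {i j} M → All (i ≢_) (endpoints M) → All (j ≢_) (endpoints M) → All (Disjoint (i , j)) M
  All-Disjoint []            _                _                = []
  All-Disjoint ((c , d) ∷ M) (i≢c ∷ i≢d ∷ i≢s) (j≢c ∷ j≢d ∷ j≢s) = (i≢c , i≢d , j≢c , j≢d) ∷ All-Disjoint M i≢s j≢s

  unique-endpoints⇒matching : ∀ {n} M → Unique (endpoints M) → All (_< n) (endpoints M) → IsMatching n M
  unique-endpoints⇒matching []            _                    _                  = [] , []
  unique-endpoints⇒matching ((i , j) ∷ M) ((i≢j ∷ i≢s) ∷ j≢s ∷ u) (i<n ∷ j<n ∷ s<n) =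
    (i<n , j<n , i≢j) ∷ proj₁ matching , All-Disjoint M i≢s j≢s ∷ proj₂ matching
    where matching = unique-endpoints⇒matching M u s<n

∈-endpoints⇒covered : ∀ {v} M → v ∈ endpoints M → Any (Covers v) M
∈-endpoints⇒covered ((i , j) ∷ M) (here v≡i)         = here (inj₁ v≡i)
∈-endpoints⇒covered ((i , j) ∷ M) (there (here v≡j)) = here (inj₂ v≡j)
∈-endpoints⇒covered ((i , j) ∷ M) (there (there v∈)) = there (∈-endpoints⇒covered M v∈)

endpoints↭upTo⇒perfectMatching : ∀ {n} M → endpoints M ↭ upTo n → IsMatching n M × IsPerfect n M
endpoints↭upTo⇒perfectMatching {n} M σ =
  unique-endpoints⇒matching M (Unique-resp-↭ (↭⇒↭ₛ (↭-sym σ)) (Unique.upTo⁺ n))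
                                (All-resp-↭ (↭-sym σ) (all-upTo n)) ,
  λ v v<n → ∈-endpoints⇒covered M (∈-resp-↭ (↭-sym σ) (∈-upTo⁺ v<n))

unique-colors⇒rainbow : ∀ {n} M → Unique (map (color n) M) → IsRainbow n M
unique-colors⇒rainbow M = AllPairs.map⁻

color-+ : ∀ n x d → color n (x , x + d) ≡ d ⊓ (n ∸ d)
color-+ n x d = cong (λ e → e ⊓ (n ∸ e)) (∣m-m+n∣≡n x d)

color-short : ∀ {n} x {y d} → x + d ≡ y → d + d ≤ n → color n (x , y) ≡ d
color-short {n} x {d = d} refl 2d≤n = trans (color-+ n x d) (m≤n⇒m⊓n≡m (m+n≤o⇒m≤o∸n d 2d≤n))

color-long : ∀ {n} x {y d t} → x + d ≡ y → d + t ≡ n → t ≤ d → color n (x , y) ≡ t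
color-long x {d = d} {t} refl refl t≤d =
  trans (color-+ (d + t) x d) (trans (cong (d ⊓_) (m+n∸m≡n d t)) (m≥n⇒m⊓n≡n t≤d))

ladder : ℕ → ℕ → ℕ → List Edge
ladder a b l = map (λ i → a + i , b ∸ i) (upTo l)

ladder-cong : ∀ {a a′ b b′ l l′} → a ≡ a′ → b ≡ b′ → l ≡ l′ → ladder a b l ≡ ladder a′ b′ l′
ladder-cong refl refl refl = refl

endpoints-ladder : ∀ a {b c} l → c + l ≡ suc b → endpoints (ladder a b l) ↭ range a l ++ range c l
endpoints-ladder a {b} l c+l≡1+b =
  ↭-trans (endpoints-map (a +_) (b ∸_) (upTo l)) (++⁺ (↭-reflexive (map-+-upTo a l)) (map-∸-upTo l c+l≡1+b))

color-long-rung : ∀ {n b l i} → b + 2 ≡ n → 4 * l ≤ b → i < l → color n (1 + i , b ∸ i) ≡ odd (1 + i)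
color-long-rung {n} {b} {l} {i} b+2≡n 4l≤b i<l
  with s , 4[1+i]+s≡b ← m≤n⇒∃[o]m+o≡n (≤-trans (*-monoʳ-≤ 4 i<l) 4l≤b) =
  color-long (1 + i) {d = odd (1 + i) + s} (sym (m≡n+o⇒m∸n≡o i b≡))
    (trans d+t≡ (trans (cong (_+ 2) 4[1+i]+s≡b) b+2≡n)) (m≤m+n (odd (1 + i)) s)
  where
  b≡ : b ≡ i + ((1 + i) + ((1 + 2 * (1 + i)) + s))
  b≡ = trans (sym 4[1+i]+s≡b) (solve (i ∷ s ∷ []))
  d+t≡ : ((1 + 2 * (1 + i)) + s) + (1 + 2 * (1 + i)) ≡ 4 * (1 + i) + s + 2
  d+t≡ = solve (i ∷ s ∷ [])

color-short-rung : ∀ {n a b h l i} → b ≡ a + 2 * h → l ≤ h → 4 * h ≤ n → i < l →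
                   color n (a + i , b ∸ i) ≡ 2 * (h ∸ i)
color-short-rung {n} {a} {b} {h} {l} {i} b≡a+2h l≤h 4h≤n i<l
  with s , i+s≡h ← m≤n⇒∃[o]m+o≡n (≤-trans (<⇒≤ i<l) l≤h) =
  trans (color-short (a + i) {d = 2 * s} (sym (m≡n+o⇒m∸n≡o i b≡)) 2d≤n)
        (cong (2 *_) (sym (m≡n+o⇒m∸n≡o i (sym i+s≡h))))
  where
  b≡ : b ≡ i + (a + i + 2 * s)
  b≡ = trans b≡a+2h (trans (cong (λ h → a + 2 * h) (sym i+s≡h)) (solve (a ∷ i ∷ s ∷ [])))
  2d≤n : 2 * s + 2 * s ≤ n
  2d≤n = begin
    2 * s + 2 * s ≡⟨ solve (s ∷ []) ⟩
    4 * s         ≤⟨ *-monoʳ-≤ 4 (m≤n+m s i) ⟩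
    4 * (i + s)   ≡⟨ cong (4 *_) i+s≡h ⟩
    4 * h         ≤⟨ 4h≤n ⟩
    n             ∎
    where open ≤-Reasoning

colors-long-ladder : ∀ {n b} l → b + 2 ≡ n → 4 * l ≤ b → map (color n) (ladder 1 b l) ≡ map odd (range 1 l)
colors-long-ladder {n} {b} l b+2≡n 4l≤b = begin
  map (color n) (ladder 1 b l)                 ≡⟨ map-∘ (upTo l) ⟨
  map (λ i → color n (1 + i , b ∸ i)) (upTo l)
    ≡⟨ map-cong-local (All.map (color-long-rung b+2≡n 4l≤b) (all-upTo l)) ⟩
  map (odd ∘ (1 +_)) (upTo l)                  ≡⟨ map-∘ (upTo l) ⟩
  map odd (map (1 +_) (upTo l))                ≡⟨ cong (map odd) (map-+-upTo 1 l) ⟩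
  map odd (range 1 l)                          ∎
  where open ≡-Reasoning

colors-short-ladder : ∀ {n a b h c} l → b ≡ a + 2 * h → l ≤ h → 4 * h ≤ n → c + l ≡ suc h →
                      map (color n) (ladder a b l) ↭ map (2 *_) (range c l)
colors-short-ladder {n} {a} {b} {h} {c} l b≡a+2h l≤h 4h≤n c+l≡1+h = begin
  map (color n) (ladder a b l)                 ≡⟨ map-∘ (upTo l) ⟨
  map (λ i → color n (a + i , b ∸ i)) (upTo l)
    ≡⟨ map-cong-local (All.map (color-short-rung {a = a} b≡a+2h l≤h 4h≤n) (all-upTo l)) ⟩
  map ((2 *_) ∘ (h ∸_)) (upTo l)               ≡⟨ map-∘ (upTo l) ⟩
  map (2 *_) (map (h ∸_) (upTo l))             ↭⟨ map⁺ (2 *_) (map-∸-upTo l c+l≡1+h) ⟩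
  map (2 *_) (range c l)                       ∎
  where open PermutationReasoning

-- {0, …, n − 1} is tiled by the intervals I₀, …, I₁₁ of lengths 1, l, 1, m + 1, m, 1, m, 1, 1,
-- m + 1, l, 1; the ladders T′, T″, T‴ join I₁ to I₁₀, I₃ to I₉ and I₄ to I₆, and vᵢ is the
-- single point of Iᵢ.
module Layout (m l : ℕ) where

  n : ℕ
  n = 8 + 2 * l + 4 * m

  T′ T″ T‴ : List Edge
  T′ = ladder 1 (6 + 2 * l + 4 * m) l
  T″ = ladder (2 + l) (6 + l + 4 * m) (1 + m)
  T‴ = ladder (3 + l + m) (3 + l + 3 * m) m

  I₁ I₃ I₄ I₆ I₉ I₁₀ : List ℕ
  I₁  = range 1 l
  I₃  = range (2 + l) (1 + m)
  I₄  = range (3 + l + m) m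
  I₆  = range (4 + l + 2 * m) m
  I₉  = range (6 + l + 3 * m) (1 + m)
  I₁₀ = range (7 + l + 4 * m) l

  v₀ v₂ v₅ v₇ v₈ v₁₁ : ℕ
  v₀  = 0
  v₂  = 1 + l
  v₅  = 3 + l + 2 * m
  v₇  = 4 + l + 3 * m
  v₈  = 5 + l + 3 * m
  v₁₁ = 7 + 2 * l + 4 * m

  private
    I₃-I₄ : 2 + l + (1 + m) ≡ 3 + l + m
    I₃-I₄ = solve (m ∷ l ∷ [])
    I₄-I₅ : 3 + l + m + m ≡ 3 + l + 2 * m
    I₄-I₅ = solve (m ∷ l ∷ [])
    I₆-I₇ : 4 + l + 2 * m + m ≡ 4 + l + 3 * m
    I₆-I₇ = solve (m ∷ l ∷ [])
    I₉-I₁₀ : 6 + l + 3 * m + (1 + m) ≡ 7 + l + 4 * m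
    I₉-I₁₀ = solve (m ∷ l ∷ [])
    I₁₀-I₁₁ : 7 + l + 4 * m + l ≡ 7 + 2 * l + 4 * m
    I₁₀-I₁₁ = solve (m ∷ l ∷ [])
    -- in the shape produced by the chain of ++-range and ∷-range in intervals-tile
    total-length : suc (l + suc (1 + m + (m + suc (m + suc (suc (1 + m + (l + 1))))))) ≡ 8 + 2 * l + 4 * m
    total-length = solve (m ∷ l ∷ [])

  intervals-tile : v₀ ∷ I₁ ++ v₂ ∷ I₃ ++ I₄ ++ v₅ ∷ I₆ ++ v₇ ∷ v₈ ∷ I₉ ++ I₁₀ ++ v₁₁ ∷ [] ≡ upTo n
  intervals-tile = trans
    (∷-range v₀ (++-range 1 l refl (∷-range v₂ (++-range (2 + l) (1 + m) I₃-I₄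
      (++-range (3 + l + m) m I₄-I₅ (∷-range v₅ (++-range (4 + l + 2 * m) m I₆-I₇
      (∷-range v₇ (∷-range v₈ (++-range (6 + l + 3 * m) (1 + m) I₉-I₁₀
      (++-range (7 + l + 4 * m) l I₁₀-I₁₁ refl)))))))))))
    (trans (cong (range 0) total-length) (sym (upTo≡range n)))

  endpoints-ladders : ∀ ss →
    endpoints (T′ ++ T″ ++ T‴ ++ ss) ↭ (I₁ ++ I₁₀) ++ (I₃ ++ I₉) ++ (I₄ ++ I₆) ++ endpoints ss
  endpoints-ladders ss = begin
    endpoints (T′ ++ T″ ++ T‴ ++ ss)
      ≡⟨ trans (endpoints-++ T′ _) (cong (endpoints T′ ++_)
           (trans (endpoints-++ T″ _) (cong (endpoints T″ ++_) (endpoints-++ T‴ ss)))) ⟩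
    endpoints T′ ++ endpoints T″ ++ endpoints T‴ ++ endpoints ss
      ↭⟨ ++⁺ (endpoints-ladder 1 l I₁₀-I₁₁)
           (++⁺ (endpoints-ladder (2 + l) (1 + m) I₉-I₁₀)
                (++⁺ʳ (endpoints ss) (endpoints-ladder (3 + l + m) m I₆-I₇))) ⟩
    _ ∎
    where open PermutationReasoning

  endpoints↭upTo : ∀ ss → endpoints ss ↭ v₀ ∷ v₂ ∷ v₅ ∷ v₇ ∷ v₈ ∷ v₁₁ ∷ [] →
                   endpoints (T′ ++ T″ ++ T‴ ++ ss) ↭ upTo n
  endpoints↭upTo ss σ = begin
    endpoints (T′ ++ T″ ++ T‴ ++ ss) ↭⟨ endpoints-ladders ss ⟩
    _                                ↭⟨ ++⁺ˡ (I₁ ++ I₁₀) (++⁺ˡ (I₃ ++ I₉) (++⁺ˡ (I₄ ++ I₆) σ)) ⟩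
    _                                ↭⟨ rearrange I₁ I₁₀ I₃ I₉ I₄ I₆
                                          (v₀ ∷ []) (v₂ ∷ []) (v₅ ∷ []) (v₇ ∷ []) (v₈ ∷ []) (v₁₁ ∷ []) ⟩
    _                                ≡⟨ intervals-tile ⟩
    upTo n                           ∎
    where
    open PermutationReasoning
    rearrange : ∀ (r₁ r₁₀ r₃ r₉ r₄ r₆ p₀ p₂ p₅ p₇ p₈ p₁₁ : List ℕ) →
      (r₁ ++ r₁₀) ++ (r₃ ++ r₉) ++ (r₄ ++ r₆) ++ p₀ ++ p₂ ++ p₅ ++ p₇ ++ p₈ ++ p₁₁
      ↭ p₀ ++ r₁ ++ p₂ ++ r₃ ++ r₄ ++ p₅ ++ r₆ ++ p₇ ++ p₈ ++ r₉ ++ r₁₀ ++ p₁₁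
    rearrange = ++-solve 12 (λ r₁ r₁₀ r₃ r₉ r₄ r₆ p₀ p₂ p₅ p₇ p₈ p₁₁ →
      (r₁ ⊕ r₁₀) ⊕ (r₃ ⊕ r₉) ⊕ (r₄ ⊕ r₆) ⊕ p₀ ⊕ p₂ ⊕ p₅ ⊕ p₇ ⊕ p₈ ⊕ p₁₁
      ⊜ p₀ ⊕ r₁ ⊕ p₂ ⊕ r₃ ⊕ r₄ ⊕ p₅ ⊕ r₆ ⊕ p₇ ⊕ p₈ ⊕ r₉ ⊕ r₁₀ ⊕ p₁₁) ↭-refl

  4l≤6+2l+4m : l ≤ 3 + 2 * m → 4 * l ≤ 6 + 2 * l + 4 * m
  4l≤6+2l+4m l≤3+2m = begin
    4 * l                   ≡⟨ solve (l ∷ []) ⟩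
    2 * l + 2 * l           ≤⟨ +-monoʳ-≤ (2 * l) (*-monoʳ-≤ 2 l≤3+2m) ⟩
    2 * l + 2 * (3 + 2 * m) ≡⟨ solve (m ∷ l ∷ []) ⟩
    6 + 2 * l + 4 * m       ∎
    where open ≤-Reasoning

  4[2+2m]≤n : 2 * m ≤ l → 4 * (2 + 2 * m) ≤ n
  4[2+2m]≤n 2m≤l = begin
    4 * (2 + 2 * m)         ≡⟨ solve (m ∷ []) ⟩
    8 + 2 * (2 * m) + 4 * m ≤⟨ +-monoˡ-≤ (4 * m) (+-monoʳ-≤ 8 (*-monoʳ-≤ 2 2m≤l)) ⟩
    8 + 2 * l + 4 * m       ∎
    where open ≤-Reasoning

  colors-ladders : 2 * m ≤ l → l ≤ 3 + 2 * m → ∀ ss → map (color n) (T′ ++ T″ ++ T‴ ++ ss) ↭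
    map odd (range 1 l) ++ map (2 *_) (range (2 + m) (1 + m)) ++ map (2 *_) (range 1 m) ++ map (color n) ss
  colors-ladders 2m≤l l≤3+2m ss = begin
    map (color n) (T′ ++ T″ ++ T‴ ++ ss)
      ≡⟨ trans (map-++ (color n) T′ _) (cong (map (color n) T′ ++_)
           (trans (map-++ (color n) T″ _) (cong (map (color n) T″ ++_) (map-++ (color n) T‴ ss)))) ⟩
    map (color n) T′ ++ map (color n) T″ ++ map (color n) T‴ ++ map (color n) ss
      ↭⟨ ++⁺ (↭-reflexive (colors-long-ladder l T′-long (4l≤6+2l+4m l≤3+2m)))
           (++⁺ (colors-short-ladder {a = 2 + l} {h = 2 + 2 * m} (1 + m) T″-span (m+n≡o⇒m≤o (1 + m) T″-rungs)
                                     (4[2+2m]≤n 2m≤l) T″-colors)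
                (++⁺ʳ (map (color n) ss)
                   (colors-short-ladder {a = 3 + l + m} {h = m} m T‴-span ≤-refl
                                        (m+n≡o⇒m≤o (8 + 2 * l) T‴-short) refl))) ⟩
    _ ∎
    where
    open PermutationReasoning
    T′-long : 6 + 2 * l + 4 * m + 2 ≡ 8 + 2 * l + 4 * m
    T′-long = solve (m ∷ l ∷ [])
    T″-span : 6 + l + 4 * m ≡ 2 + l + 2 * (2 + 2 * m)
    T″-span = solve (m ∷ l ∷ [])
    T″-rungs : 1 + m + (1 + m) ≡ 2 + 2 * m
    T″-rungs = solve (m ∷ [])
    T″-colors : 2 + m + (1 + m) ≡ suc (2 + 2 * m)
    T″-colors = solve (m ∷ [])
    T‴-span : 3 + l + 3 * m ≡ 3 + l + m + 2 * m
    T‴-span = solve (m ∷ l ∷ [])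
    T‴-short : 4 * m + (8 + 2 * l) ≡ 8 + 2 * l + 4 * m
    T‴-short = solve (m ∷ l ∷ [])

  color-values : List ℕ
  color-values = (1 ∷ map odd (range 1 l) ++ odd (1 + l) ∷ [])
                 ++ map (2 *_) (range 1 m) ++ 2 * (1 + m) ∷ map (2 *_) (range (2 + m) (1 + m))

  color-values-unique : Unique color-values
  color-values-unique =
    subst Unique (sym (cong₂ _++_ odds evens)) (odds-evens-unique 0 (suc (l + 1)) 1 (m + suc (1 + m)))
    where
    odds : 1 ∷ map odd (range 1 l) ++ odd (1 + l) ∷ [] ≡ map odd (range 0 (suc (l + 1)))
    odds = trans (cong (1 ∷_) (sym (map-++ odd (range 1 l) (1 + l ∷ []))))
                 (cong (map odd) (∷-range 0 (++-range 1 l refl refl)))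
    evens : map (2 *_) (range 1 m) ++ 2 * (1 + m) ∷ map (2 *_) (range (2 + m) (1 + m))
          ≡ map (2 *_) (range 1 (m + suc (1 + m)))
    evens = trans (sym (map-++ (2 *_) (range 1 m) _)) (cong (map (2 *_)) (++-range 1 m refl (∷-range (1 + m) refl)))

  colors↭color-values : 2 * m ≤ l → l ≤ 3 + 2 * m → ∀ ss → map (color n) ss ↭ 1 ∷ 2 * (1 + m) ∷ odd (1 + l) ∷ [] →
                        map (color n) (T′ ++ T″ ++ T‴ ++ ss) ↭ color-values
  colors↭color-values 2m≤l l≤3+2m ss τ = begin
    map (color n) (T′ ++ T″ ++ T‴ ++ ss) ↭⟨ colors-ladders 2m≤l l≤3+2m ss ⟩
    odds ++ evens₂ ++ evens₁ ++ map (color n) ss ↭⟨ ++⁺ˡ odds (++⁺ˡ evens₂ (++⁺ˡ evens₁ τ)) ⟩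
    odds ++ evens₂ ++ evens₁ ++ 1 ∷ 2 * (1 + m) ∷ odd (1 + l) ∷ []
      ↭⟨ rearrange odds evens₂ evens₁ (1 ∷ []) (2 * (1 + m) ∷ []) (odd (1 + l) ∷ []) ⟩
    color-values ∎
    where
    open PermutationReasoning
    odds evens₁ evens₂ : List ℕ
    odds   = map odd (range 1 l)
    evens₁ = map (2 *_) (range 1 m)
    evens₂ = map (2 *_) (range (2 + m) (1 + m))
    rearrange : ∀ (o e₂ e₁ p₁ q p₃ : List ℕ) →
                o ++ e₂ ++ e₁ ++ p₁ ++ q ++ p₃ ↭ (p₁ ++ o ++ p₃) ++ e₁ ++ q ++ e₂
    rearrange = ++-solve 6 (λ o e₂ e₁ p₁ q p₃ →
      o ⊕ e₂ ⊕ e₁ ⊕ p₁ ⊕ q ⊕ p₃ ⊜ (p₁ ⊕ o ⊕ p₃) ⊕ e₁ ⊕ q ⊕ e₂) ↭-refl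

  rainbowPerfect : 2 * m ≤ l → l ≤ 3 + 2 * m → ∀ ss →
    endpoints ss ↭ v₀ ∷ v₂ ∷ v₅ ∷ v₇ ∷ v₈ ∷ v₁₁ ∷ [] →
    map (color n) ss ↭ 1 ∷ 2 * (1 + m) ∷ odd (1 + l) ∷ [] →
    IsRainbowPerfectMatching n (T′ ++ T″ ++ T‴ ++ ss)
  rainbowPerfect 2m≤l l≤3+2m ss σ τ =
    proj₁ matching×perfect ,
    unique-colors⇒rainbow M (Unique-resp-↭ (↭⇒↭ₛ (↭-sym colors↭)) color-values-unique) ,
    proj₂ matching×perfect
    where
    M : List Edge
    M = T′ ++ T″ ++ T‴ ++ ss
    matching×perfect : IsMatching n M × IsPerfect n M
    matching×perfect = endpoints↭upTo⇒perfectMatching M (endpoints↭upTo ss σ)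
    colors↭ : map (color n) M ↭ color-values
    colors↭ = colors↭color-values 2m≤l l≤3+2m ss τ

module _ (m : ℕ) where
  open Layout m (2 * m)

  T̄8k : List Edge
  T̄8k = (v₀ , v₅) ∷ (v₂ , v₁₁) ∷ (v₇ , v₈) ∷ []

  T8k≡layout : T8k (suc m) ≡ T′ ++ T″ ++ T‴ ++ T̄8k
  T8k≡layout =
    cong₂ _++_ (ladder-cong refl (m≡n+o⇒m∸n≡o 2 b′) (m≡n+o⇒m∸n≡o 2 a″))
    (cong₂ _++_ (ladder-cong {l = suc m} a″ b″ refl)
    (cong₂ _++_ (ladder-cong {l = m} a‴ (m≡n+o⇒m∸n≡o 2 b‴) refl)
    (cong₂ _∷_ (cong (0 ,_) (m≡n+o⇒m∸n≡o 1 p₅))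
    (cong₂ _∷_ (cong₂ _,_ (m≡n+o⇒m∸n≡o 1 p₂) (m≡n+o⇒m∸n≡o 1 p₁₁))
    (cong (_∷ []) (cong₂ _,_ (m≡n+o⇒m∸n≡o 1 p₇) p₈))))))
    where
    b′ : 8 * suc m ≡ 2 + (6 + 2 * (2 * m) + 4 * m)
    b′ = solve (m ∷ [])
    a″ : 2 * suc m ≡ 2 + 2 * m
    a″ = solve (m ∷ [])
    b″ : 6 * suc m ≡ 6 + 2 * m + 4 * m
    b″ = solve (m ∷ [])
    a‴ : 3 * suc m ≡ 3 + 2 * m + m
    a‴ = solve (m ∷ [])
    b‴ : 5 * suc m ≡ 2 + (3 + 2 * m + 3 * m)
    b‴ = solve (m ∷ [])
    p₂ : 2 * suc m ≡ 1 + (1 + 2 * m)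
    p₂ = solve (m ∷ [])
    p₅ : 4 * suc m ≡ 1 + (3 + 2 * m + 2 * m)
    p₅ = solve (m ∷ [])
    p₇ : 5 * suc m ≡ 1 + (4 + 2 * m + 3 * m)
    p₇ = solve (m ∷ [])
    p₈ : 5 * suc m ≡ 5 + 2 * m + 3 * m
    p₈ = solve (m ∷ [])
    p₁₁ : 8 * suc m ≡ 1 + (7 + 2 * (2 * m) + 4 * m)
    p₁₁ = solve (m ∷ [])

  endpoints-T̄8k : endpoints T̄8k ↭ v₀ ∷ v₂ ∷ v₅ ∷ v₇ ∷ v₈ ∷ v₁₁ ∷ []
  endpoints-T̄8k = prep v₀ (swap v₅ v₂ (↭-sym (shift v₁₁ (v₇ ∷ v₈ ∷ []) [])))

  colors-T̄8k : map (color n) T̄8k ↭ 1 ∷ 2 * (1 + m) ∷ odd (1 + 2 * m) ∷ []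
  colors-T̄8k = ↭-trans (↭-reflexive colors) (↭-reverse (1 ∷ 2 * (1 + m) ∷ odd (1 + 2 * m) ∷ []))
    where
    v₀v₅ : 1 + 2 * (1 + 2 * m) ≡ 3 + 2 * m + 2 * m
    v₀v₅ = solve (m ∷ [])
    v₀v₅-short : 1 + 2 * (1 + 2 * m) + (1 + 2 * (1 + 2 * m)) + 2 ≡ 8 + 2 * (2 * m) + 4 * m
    v₀v₅-short = solve (m ∷ [])
    v₂v₁₁ : 1 + 2 * m + (6 + 6 * m) ≡ 7 + 2 * (2 * m) + 4 * m
    v₂v₁₁ = solve (m ∷ [])
    v₂v₁₁-long : 6 + 6 * m + 2 * (1 + m) ≡ 8 + 2 * (2 * m) + 4 * m
    v₂v₁₁-long = solve (m ∷ [])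
    v₂v₁₁-t≤d : 2 * (1 + m) + (4 + 4 * m) ≡ 6 + 6 * m
    v₂v₁₁-t≤d = solve (m ∷ [])
    v₇v₈ : 4 + 2 * m + 3 * m + 1 ≡ 5 + 2 * m + 3 * m
    v₇v₈ = solve (m ∷ [])
    colors : map (color n) T̄8k ≡ odd (1 + 2 * m) ∷ 2 * (1 + m) ∷ 1 ∷ []
    colors = cong₂ _∷_ (color-short v₀ v₀v₅ (m+n≡o⇒m≤o 2 v₀v₅-short))
               (cong₂ _∷_ (color-long v₂ v₂v₁₁ v₂v₁₁-long (m+n≡o⇒m≤o (4 + 4 * m) v₂v₁₁-t≤d))
                 (cong (_∷ []) (color-short v₇ v₇v₈ (s≤s (s≤s z≤n)))))

  T8k-rainbowPerfect : IsRainbowPerfectMatching (8 * suc m) (T8k (suc m))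
  T8k-rainbowPerfect = subst₂ IsRainbowPerfectMatching n≡8k (sym T8k≡layout)
    (rainbowPerfect ≤-refl (m+n≡o⇒m≤o 3 (+-comm (2 * m) 3)) T̄8k endpoints-T̄8k colors-T̄8k)
    where
    n≡8k : 8 + 2 * (2 * m) + 4 * m ≡ 8 * suc m
    n≡8k = solve (m ∷ [])

module _ (m : ℕ) where
  open Layout m (1 + 2 * m)

  T̄8k+2 : List Edge
  T̄8k+2 = (v₀ , v₂) ∷ (v₅ , v₁₁) ∷ (v₇ , v₈) ∷ []

  T8k+2≡layout : T8k+2 (suc m) ≡ T′ ++ T″ ++ T‴ ++ T̄8k+2
  T8k+2≡layout =
    cong₂ _++_ (ladder-cong refl b′ (m≡n+o⇒m∸n≡o 1 p₂))
    (cong₂ _++_ (ladder-cong {l = suc m} a″ b″ refl)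
    (cong₂ _++_ (ladder-cong {l = m} a‴ (m≡n+o⇒m∸n≡o 1 b‴) refl)
    (cong₂ _∷_ (cong (0 ,_) p₂)
    (cong₂ _∷_ (cong₂ _,_ p₅ p₁₁)
    (cong (_∷ []) (cong₂ _,_ p₇ p₈))))))
    where
    b′ : 8 * suc m ≡ 6 + 2 * (1 + 2 * m) + 4 * m
    b′ = solve (m ∷ [])
    a″ : 2 * suc m + 1 ≡ 2 + (1 + 2 * m)
    a″ = solve (m ∷ [])
    b″ : 6 * suc m + 1 ≡ 6 + (1 + 2 * m) + 4 * m
    b″ = solve (m ∷ [])
    a‴ : 3 * suc m + 1 ≡ 3 + (1 + 2 * m) + m
    a‴ = solve (m ∷ [])
    b‴ : 5 * suc m ≡ 1 + (3 + (1 + 2 * m) + 3 * m)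
    b‴ = solve (m ∷ [])
    p₂ : 2 * suc m ≡ 1 + (1 + 2 * m)
    p₂ = solve (m ∷ [])
    p₅ : 4 * suc m ≡ 3 + (1 + 2 * m) + 2 * m
    p₅ = solve (m ∷ [])
    p₇ : 5 * suc m ≡ 4 + (1 + 2 * m) + 3 * m
    p₇ = solve (m ∷ [])
    p₈ : 5 * suc m + 1 ≡ 5 + (1 + 2 * m) + 3 * m
    p₈ = solve (m ∷ [])
    p₁₁ : 8 * suc m + 1 ≡ 7 + 2 * (1 + 2 * m) + 4 * m
    p₁₁ = solve (m ∷ [])

  endpoints-T̄8k+2 : endpoints T̄8k+2 ↭ v₀ ∷ v₂ ∷ v₅ ∷ v₇ ∷ v₈ ∷ v₁₁ ∷ []
  endpoints-T̄8k+2 = prep v₀ (prep v₂ (prep v₅ (↭-sym (shift v₁₁ (v₇ ∷ v₈ ∷ []) []))))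

  colors-T̄8k+2 : map (color n) T̄8k+2 ↭ 1 ∷ 2 * (1 + m) ∷ odd (2 + 2 * m) ∷ []
  colors-T̄8k+2 = ↭-trans (↭-reflexive colors) (↭-sym (∷↭∷ʳ 1 (2 * (1 + m) ∷ odd (2 + 2 * m) ∷ [])))
    where
    v₀v₂ : 2 * (1 + m) ≡ 1 + (1 + 2 * m)
    v₀v₂ = solve (m ∷ [])
    v₀v₂-short : 2 * (1 + m) + 2 * (1 + m) + (6 + 4 * m) ≡ 8 + 2 * (1 + 2 * m) + 4 * m
    v₀v₂-short = solve (m ∷ [])
    v₅v₁₁ : 3 + (1 + 2 * m) + 2 * m + (1 + 2 * (2 + 2 * m)) ≡ 7 + 2 * (1 + 2 * m) + 4 * m
    v₅v₁₁ = solve (m ∷ [])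
    v₅v₁₁-short : 1 + 2 * (2 + 2 * m) + (1 + 2 * (2 + 2 * m)) ≡ 8 + 2 * (1 + 2 * m) + 4 * m
    v₅v₁₁-short = solve (m ∷ [])
    v₇v₈ : 4 + (1 + 2 * m) + 3 * m + 1 ≡ 5 + (1 + 2 * m) + 3 * m
    v₇v₈ = solve (m ∷ [])
    colors : map (color n) T̄8k+2 ≡ 2 * (1 + m) ∷ odd (2 + 2 * m) ∷ 1 ∷ []
    colors = cong₂ _∷_ (color-short v₀ v₀v₂ (m+n≡o⇒m≤o (6 + 4 * m) v₀v₂-short))
               (cong₂ _∷_ (color-short v₅ v₅v₁₁ (≤-reflexive v₅v₁₁-short))
                 (cong (_∷ []) (color-short v₇ v₇v₈ (s≤s (s≤s z≤n)))))

  T8k+2-rainbowPerfect : IsRainbowPerfectMatching (8 * suc m + 2) (T8k+2 (suc m))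
  T8k+2-rainbowPerfect = subst₂ IsRainbowPerfectMatching n≡8k+2 (sym T8k+2≡layout)
    (rainbowPerfect (n≤1+n (2 * m)) (m+n≡o⇒m≤o 2 (+-comm (1 + 2 * m) 2)) T̄8k+2 endpoints-T̄8k+2 colors-T̄8k+2)
    where
    n≡8k+2 : 8 + 2 * (1 + 2 * m) + 4 * m ≡ 8 * suc m + 2
    n≡8k+2 = solve (m ∷ [])

theorem2 : (k : ℕ) → 1 ≤ k →
    IsRainbowPerfectMatching (8 * k) (T8k k) × IsRainbowPerfectMatching (8 * k + 2) (T8k+2 k)
theorem2 (suc m) _ = T8k-rainbowPerfect m , T8k+2-rainbowPerfect m
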